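{- Let $L$ be a number field and let $v \in L$ be irrational (i.e. $v \notin \mathbb{Q}$). Then $$\min \deg_L(v) \geq [L : \mathbb{Q}(v)].$$
   Context: Let $L$ be a number field of degree $n$. A primitive element of $L$ is an $\alpha \in L$ with $\mathbb{Q}(\alpha) = L$. For such $\alpha$, every $v \in L$ can be written uniquely as $v = f(\alpha)$ with $f \in \mathbb{Q}[x]$, $\deg f \leq n-1$; the degree of $v$ with respect to $\alpha$, written $\deg_\alpha(v)$, is $\deg f$. The minimal degree of $v$ is $\min\deg_L(v) := \min_{\alpha} \deg_\alpha(v)$, the minimum over all primitive elements $\alpha$ of $L$. -}

module Defs where

open import Level using (Level; suc; _⊔_)
open import Algebra.Bundles using (CommutativeRing)
open import Data.Rational as ℚ using (ℚ)
open import Data.Nat as ℕ using (ℕ; _≤_)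
open import Data.Fin as Fin using (Fin)
open import Data.Vec using (Vec; toList; lookup)
open import Data.List using (List; []; _∷_)
open import Data.Product using (Σ; _×_; ∃; _,_)
open import Data.Bool using (Bool; true; false; _∧_; if_then_else_)
open import Relation.Nullary using (¬_)
open import Relation.Nullary.Decidable using (⌊_⌋)
open import Relation.Binary.PropositionalEquality using (_≡_)

-- Polynomials over ℚ are coefficient lists, constant term first.
-- isZeroPoly p = true iff every coefficient of p is 0.
isZeroPoly : List ℚ → Bool
isZeroPoly []       = true
isZeroPoly (c ∷ cs) = ⌊ c ℚ.≟ ℚ.0ℚ ⌋ ∧ isZeroPoly cs

-- Degree of a polynomial (largest index of a nonzero coefficient;
-- the zero polynomial gets degree 0 by convention).
deg : List ℚ → ℕ
deg []       = 0
deg (c ∷ cs) = if isZeroPoly cs then 0 else ℕ.suc (deg cs)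

module RingOps {c ℓ : Level} (R : CommutativeRing c ℓ) where
  open CommutativeRing R using (Carrier; 0#; _+_; _*_)

  sumFin : (m : ℕ) → (Fin m → Carrier) → Carrier
  sumFin ℕ.zero    f = 0#
  sumFin (ℕ.suc m) f = f Fin.zero + sumFin m (λ i → f (Fin.suc i))

  evalPoly : (ℚ → Carrier) → List ℚ → Carrier → Carrier
  evalPoly ι []       x = 0#
  evalPoly ι (a ∷ as) x = ι a + x * evalPoly ι as x

-- A number field: a field L together with a ring embedding ι : ℚ → L such that
-- L is a finite-dimensional ℚ-vector space, witnessed by a ℚ-basis of size n
-- (so n = [L : ℚ]).
record NumberField (c ℓ : Level) : Set (suc (c ⊔ ℓ)) where
  field
    commRing : CommutativeRing c ℓ
  open CommutativeRing commRing public
  open RingOps commRing public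
  field
    nontrivial : ¬ (1# ≈ 0#)
    inverses   : ∀ x → ¬ (x ≈ 0#) → ∃ λ y → x * y ≈ 1#
    ι          : ℚ → Carrier
    ι-+        : ∀ p q → ι (p ℚ.+ q) ≈ ι p + ι q
    ι-*        : ∀ p q → ι (p ℚ.* q) ≈ ι p * ι q
    ι-1        : ι ℚ.1ℚ ≈ 1#
    n          : ℕ
    basis      : Fin n → Carrier
    spans      : ∀ x → ∃ λ (a : Fin n → ℚ) → x ≈ sumFin n (λ i → ι (a i) * basis i)
    independent : ∀ (a : Fin n → ℚ) → sumFin n (λ i → ι (a i) * basis i) ≈ 0# →
                  ∀ i → a i ≡ ℚ.0ℚ

  ev : List ℚ → Carrier → Carrier
  ev = evalPoly ι

  _∈ℚ⟨_⟩ : Carrier → Carrier → Set ℓ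
  y ∈ℚ⟨ x ⟩ = ∃ λ (p : List ℚ) → ∃ λ (q : List ℚ) →
                 ¬ (ev q x ≈ 0#) × (y * ev q x ≈ ev p x)

  IsRational : Carrier → Set ℓ
  IsRational v = ∃ λ (q : ℚ) → v ≈ ι q

  IsPrimitive : Carrier → Set (c ⊔ ℓ)
  IsPrimitive α = ∀ y → y ∈ℚ⟨ α ⟩

  -- deg_α(v) = d: the (unique) f ∈ ℚ[x] with deg f ≤ n-1 and f(α) = v has degree d.
  -- f is given by its n coefficients f_0, …, f_{n-1}.
  DegWrt : Carrier → Carrier → ℕ → Set ℓ
  DegWrt α v d = ∃ λ (f : Vec ℚ n) → (ev (toList f) α ≈ v) × (deg (toList f) ≡ d)

  IsBasisOverℚ⟨_⟩ : Carrier → (m : ℕ) → (Fin m → Carrier) → Set (c ⊔ ℓ)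
  IsBasisOverℚ⟨ v ⟩ m b =
    (∀ x → ∃ λ (k : Fin m → Carrier) → (∀ i → k i ∈ℚ⟨ v ⟩) × (x ≈ sumFin m (λ i → k i * b i)))
    × (∀ (k : Fin m → Carrier) → (∀ i → k i ∈ℚ⟨ v ⟩) →
         sumFin m (λ i → k i * b i) ≈ 0# → ∀ i → k i ≈ 0#)

  RelDegree : Carrier → ℕ → Set (c ⊔ ℓ)
  RelDegree v m = ∃ λ (b : Fin m → Carrier) → IsBasisOverℚ⟨ v ⟩ m b

  MinDeg : Carrier → ℕ → Set (c ⊔ ℓ)
  MinDeg v d = (∃ λ α → IsPrimitive α × DegWrt α v d)
             × (∀ α e → IsPrimitive α → DegWrt α v e → d ≤ e)

-- Let α be primitive with v = f(α), deg f = d.  If d = 0 then v is rational,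
-- so d = e + 1.  Put K = ℚ(v).  From v = f₀ + f₁α + … + f_d α^d with f_d ≠ 0
-- we get α^d ∈ K·1 + K·α + … + K·α^(d-1); hence the K-span V of
-- 1, α, …, α^(d-1) is closed under multiplication by α and contains every
-- polynomial value p(α).  The members b₁, …, b_m of a K-basis of L lie in
-- ℚ(α); a common denominator C = q(α) ≠ 0 gives b_i·C ∈ V.  If m > d, the
-- m elements b_i·C of the d-generated K-space V are K-linearly dependent
-- (Gaussian elimination), and cancelling C yields a dependence among the
-- b_i, which is impossible.  Hence m ≤ d.
module Submission where

open import Defs
open import Level using (Level; _⊔_)
open import Data.Nat as ℕ using (ℕ; zero; suc; _≤_; _<_; s≤s)
import Data.Nat.Properties as ℕP
open import Data.Bool using (true; false)
open import Data.Bool.Properties using (∧-zeroʳ)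
open import Data.Rational as ℚ using (ℚ)
import Data.Rational.Properties as ℚP
open import Data.Fin as Fin using (Fin; zero; suc; toℕ; inject₁; fromℕ; punchIn)
import Data.Fin.Properties as FinP
open import Data.Vec using (toList)
open import Data.Vec.Functional using (insertAt)
import Data.Vec.Functional.Properties as VFP
open import Data.List using (List; []; _∷_)
open import Data.Product using (Σ; _×_; ∃; _,_; proj₁; proj₂)
open import Data.Empty using (⊥-elim)
open import Data.Maybe using (Maybe; just; nothing)
open import Function using (_∘_)
open import Relation.Nullary using (¬_; yes; no; Dec; ¬?)
open import Relation.Binary.PropositionalEquality as P using (_≡_)
import Algebra.Solver.Ring.AlmostCommutativeRing as ACR

padd : List ℚ → List ℚ → List ℚ
padd []      q       = q
padd (a ∷ p) []      = a ∷ p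
padd (a ∷ p) (b ∷ q) = (a ℚ.+ b) ∷ padd p q

pscale : ℚ → List ℚ → List ℚ
pscale a []      = []
pscale a (b ∷ p) = (a ℚ.* b) ∷ pscale a p

pmul : List ℚ → List ℚ → List ℚ
pmul []      q = []
pmul (a ∷ p) q = padd (pscale a q) (ℚ.0ℚ ∷ pmul p q)

coef : List ℚ → ℕ → ℚ
coef []       _       = ℚ.0ℚ
coef (c ∷ cs) zero    = c
coef (c ∷ cs) (suc j) = coef cs j

isZero-∷ : ∀ c cs → isZeroPoly (c ∷ cs) ≡ true → c ≡ ℚ.0ℚ × isZeroPoly cs ≡ true
isZero-∷ c cs h with c ℚ.≟ ℚ.0ℚ
isZero-∷ c cs h  | yes c≡0 = c≡0 , h
isZero-∷ c cs () | no _

leading-coef : ∀ p → isZeroPoly p ≡ false → ¬ coef p (deg p) ≡ ℚ.0ℚ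
leading-coef (c ∷ cs) h  with isZeroPoly cs in eq | c ℚ.≟ ℚ.0ℚ
leading-coef (c ∷ cs) () | true  | yes _
leading-coef (c ∷ cs) h  | true  | no c≢0 = c≢0
leading-coef (c ∷ cs) h  | false | _      = leading-coef cs eq

positive-deg⇒nonzero : ∀ p {e} → deg p ≡ suc e → isZeroPoly p ≡ false
positive-deg⇒nonzero []       ()
positive-deg⇒nonzero (c ∷ cs) h  with isZeroPoly cs
positive-deg⇒nonzero (c ∷ cs) () | true
positive-deg⇒nonzero (c ∷ cs) h  | false = ∧-zeroʳ _

top-coef : ∀ p {e} → deg p ≡ suc e → ¬ coef p (suc e) ≡ ℚ.0ℚ
top-coef p h = P.subst (λ k → ¬ coef p k ≡ ℚ.0ℚ) h (leading-coef p (positive-deg⇒nonzero p h))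

module Theory {c ℓ : Level} (L : NumberField c ℓ) where
  open NumberField L hiding (zero)
  open import Algebra.Properties.Ring ring using (x+x≈x⇒x≈0; +-inverseˡ-unique; -1*x≈-x)
  open import Relation.Binary.Reasoning.Setoid setoid

  ι-0 : ι ℚ.0ℚ ≈ 0#
  ι-0 = x+x≈x⇒x≈0 (ι ℚ.0ℚ)
          (trans (sym (ι-+ ℚ.0ℚ ℚ.0ℚ)) (reflexive (P.cong ι (ℚP.+-identityʳ ℚ.0ℚ))))

  ι-neg : ∀ p → ι (ℚ.- p) ≈ - ι p
  ι-neg p = +-inverseˡ-unique (ι (ℚ.- p)) (ι p)
              (trans (sym (ι-+ (ℚ.- p) p)) (trans (reflexive (P.cong ι (ℚP.+-inverseˡ p))) ι-0))

  ι-morphism : ℚ.+-*-rawRing ACR.-Raw-AlmostCommutative⟶ ACR.fromCommutativeRing commRing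
  ι-morphism = record { ⟦_⟧ = ι ; +-homo = ι-+ ; *-homo = ι-* ; -‿homo = ι-neg
                      ; 0-homo = ι-0 ; 1-homo = ι-1 }

  ι-equal? : ∀ a b → Maybe (ι a ≈ ι b)
  ι-equal? a b with a ℚ.≟ b
  ... | yes P.refl = just refl
  ... | no _       = nothing

  open import Algebra.Solver.Ring ℚ.+-*-rawRing (ACR.fromCommutativeRing commRing) ι-morphism ι-equal?

  sum-cong : ∀ m {f g : Fin m → Carrier} → (∀ i → f i ≈ g i) → sumFin m f ≈ sumFin m g
  sum-cong zero    h = refl
  sum-cong (suc m) h = +-cong (h zero) (sum-cong m (h ∘ suc))

  sum-0 : ∀ m {f : Fin m → Carrier} → (∀ i → f i ≈ 0#) → sumFin m f ≈ 0#
  sum-0 zero    h = refl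
  sum-0 (suc m) h = trans (+-cong (h zero) (sum-0 m (h ∘ suc))) (+-identityʳ 0#)

  sum-+ : ∀ m (f g : Fin m → Carrier) → sumFin m (λ i → f i + g i) ≈ sumFin m f + sumFin m g
  sum-+ zero    f g = sym (+-identityʳ 0#)
  sum-+ (suc m) f g = trans (+-congˡ (sum-+ m (f ∘ suc) (g ∘ suc)))
    (solve 4 (λ a b c d → (a :+ b) :+ (c :+ d) := (a :+ c) :+ (b :+ d)) refl (f zero) (g zero) _ _)

  sum-*ˡ : ∀ m x (f : Fin m → Carrier) → x * sumFin m f ≈ sumFin m (λ i → x * f i)
  sum-*ˡ zero    x f = zeroʳ x
  sum-*ˡ (suc m) x f = trans (distribˡ x _ _) (+-congˡ (sum-*ˡ m x (f ∘ suc)))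

  sum-*ʳ : ∀ m x (f : Fin m → Carrier) → sumFin m f * x ≈ sumFin m (λ i → f i * x)
  sum-*ʳ m x f = trans (*-comm _ x) (trans (sum-*ˡ m x f) (sum-cong m (λ i → *-comm x (f i))))

  sum-swap : ∀ m d (g : Fin m → Fin d → Carrier) →
    sumFin m (λ i → sumFin d (λ j → g i j)) ≈ sumFin d (λ j → sumFin m (λ i → g i j))
  sum-swap zero    d g = sym (sum-0 d (λ j → refl))
  sum-swap (suc m) d g = trans (+-congˡ (sum-swap m d (g ∘ suc)))
    (sym (sum-+ d (λ j → g zero j) (λ j → sumFin m (λ i → g (suc i) j))))

  sum-last : ∀ e (g : Fin (suc e) → Carrier) → sumFin (suc e) g ≈ sumFin e (g ∘ inject₁) + g (fromℕ e)
  sum-last zero    g = trans (+-identityʳ _) (sym (+-identityˡ _))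
  sum-last (suc e) g = trans (+-congˡ (sum-last e (g ∘ suc))) (sym (+-assoc _ _ _))

  sum-punchIn : ∀ m (r : Fin (suc m)) (g : Fin (suc m) → Carrier) →
    sumFin (suc m) g ≈ g r + sumFin m (g ∘ punchIn r)
  sum-punchIn m       zero    g = refl
  sum-punchIn (suc m) (suc r) g = trans (+-congˡ (sum-punchIn m r (g ∘ suc)))
    (solve 3 (λ a b c → a :+ (b :+ c) := b :+ (a :+ c)) refl (g zero) _ _)

  sum-combination : ∀ m d (t : Fin m → Carrier) (a : Fin m → Fin d → Carrier) (u : Fin d → Carrier) →
    sumFin m (λ i → t i * sumFin d (λ j → a i j * u j)) ≈ sumFin d (λ j → sumFin m (λ i → t i * a i j) * u j)
  sum-combination m d t a u = begin
    sumFin m (λ i → t i * sumFin d (λ j → a i j * u j))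
      ≈⟨ sum-cong m (λ i → trans (sum-*ˡ d (t i) _) (sum-cong d (λ j → sym (*-assoc (t i) (a i j) (u j))))) ⟩
    sumFin m (λ i → sumFin d (λ j → (t i * a i j) * u j))
      ≈⟨ sum-swap m d (λ i j → (t i * a i j) * u j) ⟩
    sumFin d (λ j → sumFin m (λ i → (t i * a i j) * u j))
      ≈⟨ sum-cong d (λ j → sym (sum-*ʳ m (u j) (λ i → t i * a i j))) ⟩
    sumFin d (λ j → sumFin m (λ i → t i * a i j) * u j) ∎

  -- Equality with 0 is decidable in L: compare the ℚ-coordinates in the basis.
  zero? : ∀ x → Dec (x ≈ 0#)
  zero? x with spans x
  ... | a , x≈ with FinP.all? (λ i → a i ℚ.≟ ℚ.0ℚ)
  ... | yes a≡0 = yes (trans x≈ (sum-0 n (λ i →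
                    trans (*-congʳ (trans (reflexive (P.cong ι (a≡0 i))) ι-0)) (zeroˡ _))))
  ... | no a≢0  = no (λ x≈0 → a≢0 (independent a (trans (sym x≈) x≈0)))

  cancel-nonzero : ∀ {x y} → ¬ x ≈ 0# → x * y ≈ 0# → y ≈ 0#
  cancel-nonzero {x} {y} x≢0 xy≈0 with inverses x x≢0
  ... | w , xw≈1 = begin
    y           ≈⟨ *-identityˡ y ⟨
    1# * y      ≈⟨ *-congʳ xw≈1 ⟨
    (x * w) * y ≈⟨ solve 3 (λ x w y → (x :* w) :* y := w :* (x :* y)) refl x w y ⟩
    w * (x * y) ≈⟨ *-congˡ xy≈0 ⟩
    w * 0#      ≈⟨ zeroʳ w ⟩
    0#          ∎

  product-nonzero : ∀ {x y} → ¬ x ≈ 0# → ¬ y ≈ 0# → ¬ x * y ≈ 0#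
  product-nonzero x≢0 y≢0 xy≈0 = y≢0 (cancel-nonzero x≢0 xy≈0)

  ι-nonzero : ∀ {q} → ¬ q ≡ ℚ.0ℚ → ¬ ι q ≈ 0#
  ι-nonzero {q} q≢0 ιq≈0 = nontrivial (begin
    1#                       ≈⟨ ι-1 ⟨
    ι ℚ.1ℚ                   ≈⟨ reflexive (P.cong ι (ℚP.*-inverseʳ q {{ℚ.≢-nonZero q≢0}})) ⟨
    ι (q ℚ.* q⁻¹)            ≈⟨ ι-* q q⁻¹ ⟩
    ι q * ι q⁻¹              ≈⟨ *-congʳ ιq≈0 ⟩
    0# * ι q⁻¹               ≈⟨ zeroˡ _ ⟩
    0#                       ∎)
    where q⁻¹ = (ℚ.1/ q) {{ℚ.≢-nonZero q≢0}}

  ev-padd : ∀ p q x → ev (padd p q) x ≈ ev p x + ev q x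
  ev-padd []      q       x = sym (+-identityˡ _)
  ev-padd (a ∷ p) []      x = sym (+-identityʳ _)
  ev-padd (a ∷ p) (b ∷ q) x = begin
    ι (a ℚ.+ b) + x * ev (padd p q) x   ≈⟨ +-cong (ι-+ a b) (*-congˡ (ev-padd p q x)) ⟩
    (ι a + ι b) + x * (ev p x + ev q x) ≈⟨ solve 5 (λ A B X E F → (A :+ B) :+ X :* (E :+ F) := (A :+ X :* E) :+ (B :+ X :* F))
                                             refl (ι a) (ι b) x (ev p x) (ev q x) ⟩
    (ι a + x * ev p x) + (ι b + x * ev q x) ∎

  ev-pscale : ∀ a p x → ev (pscale a p) x ≈ ι a * ev p x
  ev-pscale a []      x = sym (zeroʳ _)
  ev-pscale a (b ∷ p) x = begin
    ι (a ℚ.* b) + x * ev (pscale a p) x ≈⟨ +-cong (ι-* a b) (*-congˡ (ev-pscale a p x)) ⟩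
    ι a * ι b + x * (ι a * ev p x)      ≈⟨ solve 4 (λ A B X E → A :* B :+ X :* (A :* E) := A :* (B :+ X :* E))
                                             refl (ι a) (ι b) x (ev p x) ⟩
    ι a * (ι b + x * ev p x)            ∎

  ev-pmul : ∀ p q x → ev (pmul p q) x ≈ ev p x * ev q x
  ev-pmul []      q x = sym (zeroˡ _)
  ev-pmul (a ∷ p) q x = begin
    ev (padd (pscale a q) (ℚ.0ℚ ∷ pmul p q)) x         ≈⟨ ev-padd (pscale a q) (ℚ.0ℚ ∷ pmul p q) x ⟩
    ev (pscale a q) x + (ι ℚ.0ℚ + x * ev (pmul p q) x) ≈⟨ +-cong (ev-pscale a q x) (+-congˡ (*-congˡ (ev-pmul p q x))) ⟩
    ι a * ev q x + (ι ℚ.0ℚ + x * (ev p x * ev q x))    ≈⟨ solve 4 (λ A Q X E → A :* Q :+ (con ℚ.0ℚ :+ X :* (E :* Q)) := (A :+ X :* E) :* Q)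
                                                           refl (ι a) (ev q x) x (ev p x) ⟩
    (ι a + x * ev p x) * ev q x                        ∎

  ev-const : ∀ a x → ev (a ∷ []) x ≈ ι a
  ev-const a x = trans (+-congˡ (zeroʳ x)) (+-identityʳ _)

  ev-one : ∀ x → ev (ℚ.1ℚ ∷ []) x ≈ 1#
  ev-one x = trans (ev-const ℚ.1ℚ x) ι-1

  ev-one-nonzero : ∀ x → ¬ ev (ℚ.1ℚ ∷ []) x ≈ 0#
  ev-one-nonzero x h = nontrivial (trans (sym (ev-one x)) h)

  ev-X : ∀ x → ev (ℚ.0ℚ ∷ ℚ.1ℚ ∷ []) x ≈ x
  ev-X x = trans (+-cong ι-0 (*-congˡ (ev-one x))) (trans (+-identityˡ _) (*-identityʳ x))

  record IsSubfield (K : Carrier → Set ℓ) : Set (c ⊔ ℓ) where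
    field
      K-cong : ∀ {y y'} → y ≈ y' → K y → K y'
      K-ι    : ∀ a → K (ι a)
      K-+    : ∀ {y z} → K y → K z → K (y + z)
      K-*    : ∀ {y z} → K y → K z → K (y * z)
      K-inv  : ∀ {y w} → K y → ¬ y ≈ 0# → y * w ≈ 1# → K w

    K-0 : K 0#
    K-0 = K-cong ι-0 (K-ι ℚ.0ℚ)

    K-1 : K 1#
    K-1 = K-cong ι-1 (K-ι ℚ.1ℚ)

    K-neg : ∀ {y} → K y → K (- y)
    K-neg {y} ky = K-cong (trans (*-congʳ (trans (ι-neg ℚ.1ℚ) (-‿cong ι-1))) (-1*x≈-x y))
                          (K-* (K-ι (ℚ.- ℚ.1ℚ)) ky)

    K-sum : ∀ m (f : Fin m → Carrier) → (∀ i → K (f i)) → K (sumFin m f)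
    K-sum zero    f h = K-0
    K-sum (suc m) f h = K-+ (h zero) (K-sum m (f ∘ suc) (h ∘ suc))

  ℚ⟨⟩-isSubfield : ∀ x → IsSubfield (_∈ℚ⟨ x ⟩)
  ℚ⟨⟩-isSubfield x = record
    { K-cong = λ { y≈y' (p , q , q≢0 , h) → p , q , q≢0 , trans (*-congʳ (sym y≈y')) h }
    ; K-ι    = λ a → (a ∷ []) , (ℚ.1ℚ ∷ []) , ev-one-nonzero x ,
                     trans (*-congˡ (ev-one x)) (trans (*-identityʳ _) (sym (ev-const a x)))
    ; K-+    = closed-+
    ; K-*    = closed-*
    ; K-inv  = closed-inv
    }
    where
      closed-+ : ∀ {y z} → y ∈ℚ⟨ x ⟩ → z ∈ℚ⟨ x ⟩ → (y + z) ∈ℚ⟨ x ⟩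
      closed-+ {y} {z} (p₁ , q₁ , q₁≢0 , h₁) (p₂ , q₂ , q₂≢0 , h₂) =
        padd (pmul p₁ q₂) (pmul p₂ q₁) , pmul q₁ q₂ ,
        (λ e → product-nonzero q₁≢0 q₂≢0 (trans (sym (ev-pmul q₁ q₂ x)) e)) ,
        (begin
          (y + z) * ev (pmul q₁ q₂) x                       ≈⟨ *-congˡ (ev-pmul q₁ q₂ x) ⟩
          (y + z) * (ev q₁ x * ev q₂ x)                     ≈⟨ solve 4 (λ Y Z A B → (Y :+ Z) :* (A :* B) := (Y :* A) :* B :+ (Z :* B) :* A)
                                                                 refl y z (ev q₁ x) (ev q₂ x) ⟩
          (y * ev q₁ x) * ev q₂ x + (z * ev q₂ x) * ev q₁ x ≈⟨ +-cong (*-congʳ h₁) (*-congʳ h₂) ⟩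
          ev p₁ x * ev q₂ x + ev p₂ x * ev q₁ x             ≈⟨ +-cong (ev-pmul p₁ q₂ x) (ev-pmul p₂ q₁ x) ⟨
          ev (pmul p₁ q₂) x + ev (pmul p₂ q₁) x             ≈⟨ ev-padd (pmul p₁ q₂) (pmul p₂ q₁) x ⟨
          ev (padd (pmul p₁ q₂) (pmul p₂ q₁)) x             ∎)

      closed-* : ∀ {y z} → y ∈ℚ⟨ x ⟩ → z ∈ℚ⟨ x ⟩ → (y * z) ∈ℚ⟨ x ⟩
      closed-* {y} {z} (p₁ , q₁ , q₁≢0 , h₁) (p₂ , q₂ , q₂≢0 , h₂) =
        pmul p₁ p₂ , pmul q₁ q₂ ,
        (λ e → product-nonzero q₁≢0 q₂≢0 (trans (sym (ev-pmul q₁ q₂ x)) e)) ,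
        (begin
          (y * z) * ev (pmul q₁ q₂) x     ≈⟨ *-congˡ (ev-pmul q₁ q₂ x) ⟩
          (y * z) * (ev q₁ x * ev q₂ x)   ≈⟨ solve 4 (λ Y Z A B → (Y :* Z) :* (A :* B) := (Y :* A) :* (Z :* B))
                                               refl y z (ev q₁ x) (ev q₂ x) ⟩
          (y * ev q₁ x) * (z * ev q₂ x)   ≈⟨ *-cong h₁ h₂ ⟩
          ev p₁ x * ev p₂ x               ≈⟨ ev-pmul p₁ p₂ x ⟨
          ev (pmul p₁ p₂) x               ∎)

      closed-inv : ∀ {y w} → y ∈ℚ⟨ x ⟩ → ¬ y ≈ 0# → y * w ≈ 1# → w ∈ℚ⟨ x ⟩
      closed-inv {y} {w} (p , q , q≢0 , h) y≢0 yw≈1 =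
        q , p , (λ e → q≢0 (cancel-nonzero y≢0 (trans h e))) ,
        (begin
          w * ev p x        ≈⟨ *-congˡ h ⟨
          w * (y * ev q x)  ≈⟨ solve 3 (λ W Y Q → W :* (Y :* Q) := (Y :* W) :* Q) refl w y (ev q x) ⟩
          (y * w) * ev q x  ≈⟨ *-congʳ yw≈1 ⟩
          1# * ev q x       ≈⟨ *-identityˡ _ ⟩
          ev q x            ∎)

  x∈ℚ⟨x⟩ : ∀ x → x ∈ℚ⟨ x ⟩
  x∈ℚ⟨x⟩ x = (ℚ.0ℚ ∷ ℚ.1ℚ ∷ []) , (ℚ.1ℚ ∷ []) , ev-one-nonzero x ,
             trans (*-congˡ (ev-one x)) (trans (*-identityʳ _) (sym (ev-X x)))

  common-denominator : ∀ {x} m (y : Fin m → Carrier) → (∀ i → y i ∈ℚ⟨ x ⟩) →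
    ∃ λ q → ¬ ev q x ≈ 0# × (∀ i → ∃ λ p → y i * ev q x ≈ ev p x)
  common-denominator {x} zero    y h = (ℚ.1ℚ ∷ []) , ev-one-nonzero x , λ ()
  common-denominator {x} (suc m) y h with h zero | common-denominator m (y ∘ suc) (h ∘ suc)
  ... | p₀ , q₀ , q₀≢0 , h₀ | q , q≢0 , num =
    pmul q₀ q , (λ e → product-nonzero q₀≢0 q≢0 (trans (sym (ev-pmul q₀ q x)) e)) , numerator
    where
      numerator : ∀ i → ∃ λ p → y i * ev (pmul q₀ q) x ≈ ev p x
      numerator zero = pmul p₀ q , (begin
        y zero * ev (pmul q₀ q) x       ≈⟨ *-congˡ (ev-pmul q₀ q x) ⟩
        y zero * (ev q₀ x * ev q x)     ≈⟨ *-assoc _ _ _ ⟨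
        (y zero * ev q₀ x) * ev q x     ≈⟨ *-congʳ h₀ ⟩
        ev p₀ x * ev q x                ≈⟨ ev-pmul p₀ q x ⟨
        ev (pmul p₀ q) x                ∎)
      numerator (suc i) with num i
      ... | p , hᵢ = pmul p q₀ , (begin
        y (suc i) * ev (pmul q₀ q) x    ≈⟨ *-congˡ (ev-pmul q₀ q x) ⟩
        y (suc i) * (ev q₀ x * ev q x)  ≈⟨ solve 3 (λ Y A B → Y :* (A :* B) := (Y :* B) :* A) refl (y (suc i)) (ev q₀ x) (ev q x) ⟩
        (y (suc i) * ev q x) * ev q₀ x  ≈⟨ *-congʳ hᵢ ⟩
        ev p x * ev q₀ x                ≈⟨ ev-pmul p q₀ x ⟨
        ev (pmul p q₀) x                ∎)

  pow : Carrier → ℕ → Carrier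
  pow x zero    = 1#
  pow x (suc k) = x * pow x k

  powers : Carrier → (d : ℕ) → Fin d → Carrier
  powers x d j = pow x (toℕ j)

  isZero-ev : ∀ p x → isZeroPoly p ≡ true → ev p x ≈ 0#
  isZero-ev []       x h = refl
  isZero-ev (c ∷ cs) x h with isZero-∷ c cs h
  ... | c≡0 , cs≡0 = begin
    ι c + x * ev cs x ≈⟨ +-cong (reflexive (P.cong ι c≡0)) (*-congˡ (isZero-ev cs x cs≡0)) ⟩
    ι ℚ.0ℚ + x * 0#   ≈⟨ +-cong ι-0 (zeroʳ x) ⟩
    0# + 0#           ≈⟨ +-identityʳ 0# ⟩
    0#                ∎

  horner : ∀ p x → ev p x ≈ sumFin (suc (deg p)) (λ j → ι (coef p (toℕ j)) * powers x (suc (deg p)) j)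
  horner []       x = sym (trans (+-identityʳ _) (trans (*-identityʳ _) ι-0))
  horner (c ∷ cs) x with isZeroPoly cs in eq
  ... | true = begin
    ι c + x * ev cs x  ≈⟨ +-congˡ (trans (*-congˡ (isZero-ev cs x eq)) (zeroʳ x)) ⟩
    ι c + 0#           ≈⟨ +-congʳ (*-identityʳ (ι c)) ⟨
    ι c * 1# + 0#      ∎
  ... | false = +-cong (sym (*-identityʳ (ι c))) (begin
    x * ev cs x
      ≈⟨ *-congˡ (horner cs x) ⟩
    x * sumFin (suc (deg cs)) (λ j → ι (coef cs (toℕ j)) * pow x (toℕ j))
      ≈⟨ sum-*ˡ (suc (deg cs)) x (λ j → ι (coef cs (toℕ j)) * pow x (toℕ j)) ⟩
    sumFin (suc (deg cs)) (λ j → x * (ι (coef cs (toℕ j)) * pow x (toℕ j)))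
      ≈⟨ sum-cong (suc (deg cs)) (λ j → solve 3 (λ X A B → X :* (A :* B) := A :* (X :* B))
                                          refl x (ι (coef cs (toℕ j))) (pow x (toℕ j))) ⟩
    sumFin (suc (deg cs)) (λ j → ι (coef cs (toℕ j)) * (x * pow x (toℕ j))) ∎)

  horner-deg : ∀ p x {d} → deg p ≡ d → ev p x ≈ sumFin (suc d) (λ j → ι (coef p (toℕ j)) * powers x (suc d) j)
  horner-deg p x P.refl = horner p x

  -- Linear algebra over a subfield K of L.
  module OverSubfield {K : Carrier → Set ℓ} (isK : IsSubfield K) where
    open IsSubfield isK

    RowDependence : ∀ m d → (Fin m → Fin d → Carrier) → Set (c ⊔ ℓ)
    RowDependence m d a = Σ (Fin m → Carrier) λ t → (∀ i → K (t i)) × (∃ λ i → ¬ t i ≈ 0#) ×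
                            (∀ j → sumFin m (λ i → t i * a i j) ≈ 0#)

    e₀ : ∀ {m} → Fin (suc m) → Carrier
    e₀ zero    = 1#
    e₀ (suc _) = 0#

    e₀∈K : ∀ {m} (i : Fin (suc m)) → K (e₀ i)
    e₀∈K zero    = K-1
    e₀∈K (suc _) = K-0

    insertAt-all : ∀ {m} {Q : Carrier → Set ℓ} (s : Fin m → Carrier) r x →
                   (∀ i → Q (s i)) → Q x → ∀ i → Q (insertAt s r x i)
    insertAt-all         s zero    x hs hx zero    = hx
    insertAt-all         s zero    x hs hx (suc j) = hs j
    insertAt-all {suc m} s (suc r) x hs hx zero    = hs zero
    insertAt-all {suc m} s (suc r) x hs hx (suc j) = insertAt-all (s ∘ suc) r x (hs ∘ suc) hx j

    drop-zero-column : ∀ m d (a : Fin m → Fin (suc d) → Carrier) → (∀ i → a i zero ≈ 0#) →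
      RowDependence m d (λ i j → a i (suc j)) → RowDependence m (suc d) a
    drop-zero-column m d a a₀≈0 (t , kt , nt , rest) = t , kt , nt , columns
      where
        columns : ∀ j → sumFin m (λ i → t i * a i j) ≈ 0#
        columns zero    = sum-0 m (λ i → trans (*-congˡ (a₀≈0 i)) (zeroʳ _))
        columns (suc j) = rest j

    -- Let row r have pivot a r 0 with inverse w.
    -- Subtracting (a i 0 · w) × row r from every other row i and dropping the
    -- first column gives the reduced matrix; a relation s among its rows
    -- extends to one among the rows of a, with coefficient -(Σ s_i a_i0)·w
    -- at row r.
    module Elimination {m d} (a : Fin (suc m) → Fin (suc d) → Carrier) (r : Fin (suc m))
                       (w : Carrier) (pivot : a r zero * w ≈ 1#) where

      reduced : Fin m → Fin d → Carrier
      reduced i j = a (punchIn r i) (suc j) + (- (a (punchIn r i) zero * w)) * a r (suc j)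

      others : (Fin m → Carrier) → Fin (suc d) → Carrier
      others s j = sumFin m (λ i → s i * a (punchIn r i) j)

      pivot-coef : (Fin m → Carrier) → Carrier
      pivot-coef s = - (others s zero * w)

      extend : (Fin m → Carrier) → Fin (suc m) → Carrier
      extend s = insertAt s r (pivot-coef s)

      extend-sum : ∀ s j → sumFin (suc m) (λ i → extend s i * a i j) ≈ pivot-coef s * a r j + others s j
      extend-sum s j = trans (sum-punchIn m r (λ i → extend s i * a i j))
        (+-cong (*-congʳ (reflexive (VFP.insertAt-lookup s r (pivot-coef s))))
                (sum-cong m (λ i → *-congʳ (reflexive (VFP.insertAt-punchIn s r (pivot-coef s) i)))))

      -- The pivot coefficient is chosen to clear the first column.
      extend-column₀ : ∀ s → sumFin (suc m) (λ i → extend s i * a i zero) ≈ 0#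
      extend-column₀ s = begin
        sumFin (suc m) (λ i → extend s i * a i zero) ≈⟨ extend-sum s zero ⟩
        pivot-coef s * a r zero + S₀                 ≈⟨ solve 3 (λ S W A → (:- (S :* W)) :* A :+ S := S :+ :- (S :* (A :* W)))
                                                          refl S₀ w (a r zero) ⟩
        S₀ + - (S₀ * (a r zero * w))                 ≈⟨ +-congˡ (-‿cong (trans (*-congˡ pivot) (*-identityʳ S₀))) ⟩
        S₀ + - S₀                                    ≈⟨ -‿inverseʳ S₀ ⟩
        0#                                           ∎
        where S₀ = others s zero

      extend-column : ∀ s j → sumFin (suc m) (λ i → extend s i * a i (suc j)) ≈ sumFin m (λ i → s i * reduced i j)
      extend-column s j = begin
        sumFin (suc m) (λ i → extend s i * a i (suc j))
          ≈⟨ extend-sum s (suc j) ⟩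
        pivot-coef s * C + T
          ≈⟨ solve 4 (λ S W C T → (:- (S :* W)) :* C :+ T := T :+ (:- (W :* C)) :* S) refl S₀ w C T ⟩
        T + (- (w * C)) * S₀
          ≈⟨ +-congˡ (sum-*ˡ m (- (w * C)) _) ⟩
        T + sumFin m (λ i → (- (w * C)) * (s i * a (punchIn r i) zero))
          ≈⟨ sum-+ m _ _ ⟨
        sumFin m (λ i → s i * a (punchIn r i) (suc j) + (- (w * C)) * (s i * a (punchIn r i) zero))
          ≈⟨ sum-cong m (λ i → solve 5 (λ S A B W C → S :* (A :+ (:- (B :* W)) :* C) := S :* A :+ (:- (W :* C)) :* (S :* B))
                                   refl (s i) (a (punchIn r i) (suc j)) (a (punchIn r i) zero) w C) ⟨
        sumFin m (λ i → s i * reduced i j) ∎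
        where
          S₀ = others s zero
          C  = a r (suc j)
          T  = others s (suc j)

      lift : (∀ i j → K (a i j)) → K w → RowDependence m d reduced → RowDependence (suc m) (suc d) a
      lift ka kw (s , ks , (i' , s≢0) , rel) = extend s , extend∈K , nonzero , columns
        where
          extend∈K : ∀ i → K (extend s i)
          extend∈K = insertAt-all {Q = K} s r (pivot-coef s) ks
                       (K-neg (K-* (K-sum m _ (λ i → K-* (ks i) (ka _ _))) kw))
          nonzero : ∃ λ i → ¬ extend s i ≈ 0#
          nonzero = punchIn r i' , λ h → s≢0 (trans (sym (reflexive (VFP.insertAt-punchIn s r (pivot-coef s) i'))) h)
          columns : ∀ j → sumFin (suc m) (λ i → extend s i * a i j) ≈ 0#
          columns zero    = extend-column₀ s
          columns (suc j) = trans (extend-column s j) (rel j)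

    rows-dependent : ∀ d m → d < m → (a : Fin m → Fin d → Carrier) → (∀ i j → K (a i j)) →
                     RowDependence m d a
    rows-dependent zero (suc m) _ a ka = e₀ , e₀∈K , (zero , nontrivial) , λ ()
    rows-dependent (suc d) (suc m) (s≤s d<m) a ka with FinP.any? (λ i → ¬? (zero? (a i zero)))
    ... | no no-pivot = drop-zero-column (suc m) d a first-column-zero
                          (rows-dependent d (suc m) (ℕP.m<n⇒m<1+n d<m) (λ i j → a i (suc j)) (λ i j → ka i (suc j)))
      where
        first-column-zero : ∀ i → a i zero ≈ 0#
        first-column-zero i with zero? (a i zero)
        ... | yes h = h
        ... | no h  = ⊥-elim (no-pivot (i , h))
    ... | yes (r , pivot≢0) with inverses (a r zero) pivot≢0
    ...   | w , pivot = lift ka kw (rows-dependent d m d<m reduced reduced∈K)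
      where
        open Elimination a r w pivot
        kw : K w
        kw = K-inv (ka r zero) pivot≢0 pivot
        reduced∈K : ∀ i j → K (reduced i j)
        reduced∈K i j = K-+ (ka _ _) (K-* (K-neg (K-* (ka _ _) kw)) (ka _ _))

    InSpan : ∀ {d} → (Fin d → Carrier) → Carrier → Set (c ⊔ ℓ)
    InSpan {d} u y = Σ (Fin d → Carrier) λ k → (∀ j → K (k j)) × (y ≈ sumFin d (λ j → k j * u j))

    span-cong : ∀ {d} (u : Fin d → Carrier) {y y'} → y ≈ y' → InSpan u y → InSpan u y'
    span-cong u y≈y' (k , kk , h) = k , kk , trans (sym y≈y') h

    span-0 : ∀ {d} (u : Fin d → Carrier) → InSpan u 0#
    span-0 {d} u = (λ _ → 0#) , (λ _ → K-0) , sym (sum-0 d (λ j → zeroˡ _))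

    span-+ : ∀ {d} (u : Fin d → Carrier) {y z} → InSpan u y → InSpan u z → InSpan u (y + z)
    span-+ {d} u (k₁ , kk₁ , h₁) (k₂ , kk₂ , h₂) =
      (λ j → k₁ j + k₂ j) , (λ j → K-+ (kk₁ j) (kk₂ j)) ,
      trans (+-cong h₁ h₂) (trans (sym (sum-+ d (λ j → k₁ j * u j) (λ j → k₂ j * u j)))
                                  (sum-cong d (λ j → sym (distribʳ (u j) (k₁ j) (k₂ j)))))

    span-scale : ∀ {d} (u : Fin d → Carrier) {s y} → K s → InSpan u y → InSpan u (s * y)
    span-scale {d} u {s} ks (k , kk , h) =
      (λ j → s * k j) , (λ j → K-* ks (kk j)) ,
      trans (*-congˡ h) (trans (sum-*ˡ d s (λ j → k j * u j)) (sum-cong d (λ j → sym (*-assoc s (k j) (u j)))))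

    relation-from-coordinates : ∀ {d m} (u : Fin d → Carrier) (b : Fin m → Carrier) (C : Carrier) →
      ¬ C ≈ 0# → (a : Fin m → Fin d → Carrier) → (∀ i → b i * C ≈ sumFin d (λ j → a i j * u j)) →
      (t : Fin m → Carrier) → (∀ j → sumFin m (λ i → t i * a i j) ≈ 0#) →
      sumFin m (λ i → t i * b i) ≈ 0#
    relation-from-coordinates {d} {m} u b C C≢0 a coords t rel = cancel-nonzero C≢0 (begin
      C * sumFin m (λ i → t i * b i)                       ≈⟨ sum-*ˡ m C _ ⟩
      sumFin m (λ i → C * (t i * b i))                     ≈⟨ sum-cong m (λ i → solve 3 (λ C T B → C :* (T :* B) := T :* (B :* C))
                                                                refl C (t i) (b i)) ⟩
      sumFin m (λ i → t i * (b i * C))                     ≈⟨ sum-cong m (λ i → *-congˡ (coords i)) ⟩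
      sumFin m (λ i → t i * sumFin d (λ j → a i j * u j))  ≈⟨ sum-combination m d t a u ⟩
      sumFin d (λ j → sumFin m (λ i → t i * a i j) * u j)  ≈⟨ sum-0 d (λ j → trans (*-congʳ (rel j)) (zeroˡ _)) ⟩
      0#                                                   ∎)

    span-bound : ∀ {d m} (u : Fin d → Carrier) (b : Fin m → Carrier) (C : Carrier) → ¬ C ≈ 0# →
      (∀ i → InSpan u (b i * C)) →
      (∀ k → (∀ i → K (k i)) → sumFin m (λ i → k i * b i) ≈ 0# → ∀ i → k i ≈ 0#) →
      m ≤ d
    span-bound {d} {m} u b C C≢0 bC∈span indep with m ℕ.≤? d
    ... | yes m≤d = m≤d
    ... | no m≰d with rows-dependent d m (ℕP.≰⇒> m≰d) (proj₁ ∘ bC∈span) (proj₁ ∘ proj₂ ∘ bC∈span)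
    ...   | t , kt , (i₀ , tᵢ₀≢0) , rel =
      ⊥-elim (tᵢ₀≢0 (indep t kt (relation-from-coordinates u b C C≢0 _ (proj₂ ∘ proj₂ ∘ bC∈span) t rel) i₀))

    -- The K-span V of 1, α, …, α^e.  It contains 1, and once it contains
    -- α^(e+1) it is closed under multiplication by α, hence contains every
    -- polynomial value p(α).
    module PowerSpan (α : Carrier) (e : ℕ) where

      U : Fin (suc e) → Carrier
      U = powers α (suc e)

      V : Carrier → Set (c ⊔ ℓ)
      V = InSpan U

      one∈V : V 1#
      one∈V = e₀ , e₀∈K , sym (trans (+-cong (*-identityʳ 1#) (sum-0 e (λ j → zeroˡ _))) (+-identityʳ 1#))

      -- α · Σ_{j ≤ e} k_j α^j = Σ_{1 ≤ j ≤ e} k_{j-1} α^j + k_e α^(e+1).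
      α-closed : V (pow α (suc e)) → ∀ {y} → V y → V (α * y)
      α-closed top {y} (k , kk , h) = span-cong U (sym shifted) (span-+ U (k' , kk' , refl) (span-scale U (kk (fromℕ e)) top))
        where
          k' : Fin (suc e) → Carrier
          k' zero    = 0#
          k' (suc j) = k (inject₁ j)
          kk' : ∀ j → K (k' j)
          kk' zero    = K-0
          kk' (suc j) = kk (inject₁ j)
          g : Fin (suc e) → Carrier
          g j = k j * pow α (suc (toℕ j))
          shifted : α * y ≈ sumFin (suc e) (λ j → k' j * U j) + k (fromℕ e) * pow α (suc e)
          shifted = begin
            α * y                                            ≈⟨ *-congˡ h ⟩
            α * sumFin (suc e) (λ j → k j * pow α (toℕ j))   ≈⟨ sum-*ˡ (suc e) α (λ j → k j * pow α (toℕ j)) ⟩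
            sumFin (suc e) (λ j → α * (k j * pow α (toℕ j))) ≈⟨ sum-cong (suc e) (λ j → solve 3 (λ A K U → A :* (K :* U) := K :* (A :* U))
                                                                  refl α (k j) (pow α (toℕ j))) ⟩
            sumFin (suc e) g                                 ≈⟨ sum-last e g ⟩
            sumFin e (g ∘ inject₁) + g (fromℕ e)             ≈⟨ +-cong
                (trans (sum-cong e (λ j → reflexive (P.cong (λ t → k (inject₁ j) * pow α (suc t)) (FinP.toℕ-inject₁ j))))
                       (sym (trans (+-congʳ (zeroˡ _)) (+-identityˡ _))))
                (reflexive (P.cong (λ t → k (fromℕ e) * pow α (suc t)) (FinP.toℕ-fromℕ e))) ⟩
            sumFin (suc e) (λ j → k' j * pow α (toℕ j)) + k (fromℕ e) * pow α (suc e) ∎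

      polynomial∈V : V (pow α (suc e)) → ∀ p → V (ev p α)
      polynomial∈V top []      = span-0 U
      polynomial∈V top (a ∷ p) =
        span-+ U (span-cong U (*-identityʳ _) (span-scale U (K-ι a) one∈V)) (α-closed top (polynomial∈V top p))

      -- If v ∈ K is a ℚ-combination of 1, α, …, α^(e+1) with nonzero top
      -- coefficient, then α^(e+1) ∈ V: solve for it.
      top-power∈V : ∀ {v} (f : ℕ → ℚ) → K v →
        v ≈ sumFin (suc (suc e)) (λ j → ι (f (toℕ j)) * powers α (suc (suc e)) j) → ¬ f (suc e) ≡ ℚ.0ℚ →
        V (pow α (suc e))
      top-power∈V {v} f kv v≈ f≢0 with inverses (ι (f (suc e))) (ι-nonzero f≢0)
      ... | w , lead·w≈1 = span-cong U solved (span-+ U (span-scale U (K-* kw kv) one∈V) (span-scale U (K-neg kw) S∈V))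
        where
          lead = ι (f (suc e))
          P'   = pow α (suc e)
          S    = sumFin (suc e) (λ j → ι (f (toℕ j)) * U j)
          S∈V : V S
          S∈V = (λ j → ι (f (toℕ j))) , (λ j → K-ι _) , refl
          kw : K w
          kw = K-inv (K-ι _) (ι-nonzero f≢0) lead·w≈1
          g : Fin (suc (suc e)) → Carrier
          g j = ι (f (toℕ j)) * pow α (toℕ j)
          v-split : v ≈ S + lead * P'
          v-split = trans v≈ (trans (sum-last (suc e) g)
            (+-cong (sum-cong (suc e) (λ j → reflexive (P.cong (λ i → ι (f i) * pow α i) (FinP.toℕ-inject₁ j))))
                    (reflexive (P.cong (λ i → ι (f i) * pow α i) (FinP.toℕ-fromℕ (suc e))))))
          solved : (w * v) * 1# + (- w) * S ≈ P'
          solved = begin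
            (w * v) * 1# + (- w) * S         ≈⟨ +-congʳ (trans (*-identityʳ _) (*-congˡ v-split)) ⟩
            w * (S + lead * P') + (- w) * S  ≈⟨ solve 4 (λ W S C P → W :* (S :+ C :* P) :+ (:- W) :* S := (C :* W) :* P)
                                                  refl w S lead P' ⟩
            (lead * w) * P'                  ≈⟨ *-congʳ lead·w≈1 ⟩
            1# * P'                          ≈⟨ *-identityˡ P' ⟩
            P'                               ∎

  deg-zero⇒rational : ∀ {α v} → DegWrt α v 0 → IsRational v
  deg-zero⇒rational {α} (f , f[α]≈v , deg≡0) =
    coef (toList f) 0 , trans (sym f[α]≈v) (trans (horner-deg (toList f) α deg≡0) (trans (+-identityʳ _) (*-identityʳ _)))

  relDegree≤deg : ∀ {α v} e → IsPrimitive α → DegWrt α v (suc e) → ∀ m → RelDegree v m → m ≤ suc e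
  relDegree≤deg {α} {v} e prim (f , f[α]≈v , deg≡) m (b , _ , indep) with common-denominator m b (prim ∘ b)
  ... | q , q≢0 , num = span-bound U b (ev q α) q≢0 bq∈V indep
    where
      open OverSubfield (ℚ⟨⟩-isSubfield v)
      open PowerSpan α e
      expansion : v ≈ sumFin (suc (suc e)) (λ j → ι (coef (toList f) (toℕ j)) * powers α (suc (suc e)) j)
      expansion = trans (sym f[α]≈v) (horner-deg (toList f) α deg≡)
      top : V (pow α (suc e))
      top = top-power∈V (coef (toList f)) (x∈ℚ⟨x⟩ v) expansion (top-coef (toList f) deg≡)
      bq∈V : ∀ i → V (b i * ev q α)
      bq∈V i = span-cong U (sym (proj₂ (num i))) (polynomial∈V top (proj₁ (num i)))

proposition2p1 : ∀ {c ℓ : Level} (L : NumberField c ℓ) (v : NumberField.Carrier L) →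
    ¬ NumberField.IsRational L v →
    ∀ (d m : ℕ) → NumberField.MinDeg L v d → NumberField.RelDegree L v m → m ≤ d
proposition2p1 L v irrational zero    m ((α , _ , deg₀) , _) _ =
  ⊥-elim (irrational (Theory.deg-zero⇒rational L deg₀))
proposition2p1 L v irrational (suc e) m ((α , α-primitive , degₑ) , _) relDeg =
  Theory.relDegree≤deg L e α-primitive degₑ m relDeg
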